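{- Let $m\ge1$, $0\le r\le2m$ and $0\le k\le m$. Then (a) $|\Theta^{(r)}|=\binom{2m}{r}$; (b) $|\Theta_k|=2\binom{2m}{k}$ if $k<m$, and $|\Theta_m|=\binom{2m}{m}-1$; (c) if $k\in M_r$, then $|\Theta^{(r)}_k|=2\binom{m}{(m-r+k)/2}\binom{m}{(k+r-m)/2}$ if $k<m$, and $|\Theta^{(r)}_m|=\binom{m}{r/2}^2$, where $\binom ab:=0$ if $b<0$.
   Context: Let $\zeta\in\overline{\mathbb F}_2$ be a primitive $(4^m-1)$-th root of unity. For $0\le u\le 4^m-1$ write $u=\sum_{i=0}^{2m-1}u_i2^i$ with $u_i\in\{0,1\}$, $\mathrm{wt}_2(u)=\sum u_i$, $O(u)=\#\{0\le i\le m-1:u_{2i+1}=1\}$, $E(u)=\#\{0\le i\le m-1:u_{2i}=1\}$. $\Theta^{(r)}=\{\zeta^u:0\le u\le4^m-1,\mathrm{wt}_2(u)=2m-r\}$, $\Theta_k=\{\zeta^u:0\le u\le4^m-1,|O(u)-E(u)|=m-k\}$, $\Theta^{(r)}_k=\Theta^{(r)}\cap\Theta_k$ (subsets of $\overline{\mathbb F}_2$, so $\zeta^0=\zeta^{4^m-1}=1$ counts once). $M_r=\{0\le k\le m:m-k\text{ even}\}$ for $r$ even and $\{0\le k\le m:m-k\text{ odd}\}$ for $r$ odd. -}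

module Defs where

open import Data.Nat using (ℕ; zero; suc; _+_; _*_; _∸_; _^_; _≡ᵇ_; ∣_-_∣)
open import Data.Nat.DivMod using (_/_; _%_)
open import Data.Nat.Combinatorics using (_C_)
open import Data.Bool using (Bool; true; false; _∧_; _∨_; if_then_else_)
open import Data.List using (List; upTo; filter; length; map)
open import Data.Nat.ListAction using (sum)
open import Data.Bool.ListAction using (any)
open import Data.Integer using (ℤ; +_; -[1+_])
open import Data.Integer.DivMod using (_/ℕ_)
open import Relation.Nullary.Decidable using (does)
open import Relation.Unary using (Decidable)
open import Data.Bool.Properties using () renaming (_≟_ to _≟B_)
open import Relation.Binary.PropositionalEquality using (_≡_)

digit : ℕ → ℕ → ℕ
digit u zero = u % 2
digit u (suc i) = digit (u / 2) i

wt2 : ℕ → ℕ → ℕ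
wt2 m u = sum (map (digit u) (upTo (2 * m)))

Ocnt : ℕ → ℕ → ℕ
Ocnt m u = sum (map (λ i → digit u (2 * i + 1)) (upTo m))

Ecnt : ℕ → ℕ → ℕ
Ecnt m u = sum (map (λ i → digit u (2 * i)) (upTo m))

-- N = 4^m - 1, the order of ζ
ord : ℕ → ℕ
ord m = 4 ^ m ∸ 1

-- Cardinality of the subset { ζ^u : 0 ≤ u ≤ 4^m - 1, P u } of F̄₂.
-- Since ζ is a primitive N-th root of unity (N = 4^m - 1), ζ^u = ζ^v iff
-- u ≡ v (mod N), so the elements ζ^v for 0 ≤ v < N are pairwise distinct and
-- exhaust all powers.  The set therefore has as many elements as there are
-- residues v ∈ [0, N) hit by some admissible exponent u ∈ [0, N] with P u.
-- (In particular ζ^0 = ζ^N = 1 counts once.)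
hit : ℕ → (ℕ → Bool) → ℕ → Bool
hit m P v = any (λ u → P u ∧ eqmod u) (upTo (suc (ord m)))
  where
  -- for 0 ≤ u ≤ N: (u mod N) = v, with N mod N = 0
  eqmod : ℕ → Bool
  eqmod u = if (u ≡ᵇ ord m) then (v ≡ᵇ 0) else (u ≡ᵇ v)

card : ℕ → (ℕ → Bool) → ℕ
card m P = length (filter (λ v → hit m P v ≟B true) (upTo (ord m)))

inΘr : ℕ → ℕ → ℕ → Bool
inΘr m r u = wt2 m u ≡ᵇ (2 * m ∸ r)

inΘk : ℕ → ℕ → ℕ → Bool
inΘk m k u = ∣ Ocnt m u - Ecnt m u ∣ ≡ᵇ (m ∸ k)

cardΘr : ℕ → ℕ → ℕ
cardΘr m r = card m (inΘr m r)

cardΘk : ℕ → ℕ → ℕ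
cardΘk m k = card m (inΘk m k)

cardΘrk : ℕ → ℕ → ℕ → ℕ
cardΘrk m r k = card m (λ u → inΘr m r u ∧ inΘk m k u)

inM : ℕ → ℕ → ℕ → Set
inM m r k = (m ∸ k) % 2 ≡ r % 2

choose : ℕ → ℤ → ℕ
choose a (+ b) = a C b
choose a -[1+ b ] = 0

{-# OPTIONS --safe #-}

-- Since ζ has order N = 4^m − 1, the exponents u ∈ [0, N] give pairwise distinct powers
-- except that ζ^0 = ζ^N; so each cardinality is the number of u < 4^m in the set, minus one
-- when both 0 and N = (11…1)₂ belong to it (which happens only for Θ_m).
-- Reading u in base 4, every digit contributes one odd and one even bit independently, so the
-- number of u < 4^m with O(u) = a and E(u) = b is C(m,a)·C(m,b), while both O + E and
-- O + (m − E) take the value j for C(2m,j) of them. Θ^(r) is a level set of O + E, Θ_k is the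
-- union of the level sets m ± (m − k) of O + (m − E), and Θ^(r)_k consists of those u whose
-- pair (O, E) is one of the at most two points with O + E = 2m − r and |O − E| = m − k.

module Submission where

open import Defs
open import Data.Bool using (Bool; true; false; _∧_; _∨_; T; if_then_else_)
open import Data.Bool.ListAction using (any)
open import Data.Bool.Properties using (∧-zeroʳ; ∨-identityʳ; T-∧) renaming (_≟_ to _≟B_)
open import Data.Integer using (+_; -[1+_]; _⊖_)
  renaming (_+_ to _+ℤ_; _-_ to _-ℤ_; _≤_ to _≤ℤ_)
open import Data.Integer.DivMod using (_/ℕ_; [n/ℕd]*d≤n)
import Data.Integer.Properties as ℤ
open import Data.List using (upTo; applyUpTo; filter; length; map)
open import Data.List.Properties using (map-applyUpTo; map-upTo; map-cong)
open import Data.List.Membership.Propositional using (find; lose)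
open import Data.List.Membership.Propositional.Properties using (∈-upTo⁺; ∈-upTo⁻)
open import Data.List.Relation.Unary.Any.Properties using (any⁺; any⁻)
open import Data.Nat
open import Data.Nat.Properties
open import Data.Nat.Combinatorics using (_C_; nCk+nC[k+1]≡[n+1]C[k+1]; nCk≡nC[n∸k]; k>n⇒nCk≡0)
open import Data.Nat.DivMod
open import Data.Nat.Divisibility using (_∣_; divides; ∣m+n∣m⇒∣n; m%n≡0⇒n∣m)
open import Data.Nat.ListAction using (sum)
open import Data.Nat.Tactic.RingSolver using (solve-∀)
open import Data.Product using (_×_; _,_; ∃-syntax)
open import Data.Sum using (_⊎_; inj₁; inj₂; [_,_]; map₂)
open import Function using (_∘_; _⇔_; mk⇔; Equivalence)
open import Relation.Binary.PropositionalEquality hiding ([_])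
open import Relation.Nullary using (¬_; contradiction; Dec; yes; no)
open import Relation.Nullary.Reflects
  using (Reflects; ofʸ; ofⁿ; det; fromEquivalence; T-reflects; _×-reflects_; _⊎-reflects_)

toℕ : Bool → ℕ
toℕ false = 0
toℕ true  = 1

≡ᵇ-reflects-≡ : ∀ m n → Reflects (m ≡ n) (m ≡ᵇ n)
≡ᵇ-reflects-≡ m n = fromEquivalence (≡ᵇ⇒≡ m n) (≡⇒≡ᵇ m n)

det-⇔ : ∀ {A B : Set} {a b} → Reflects A a → Reflects B b → A ⇔ B → a ≡ b
det-⇔ (ofʸ _)  (ofʸ _)  _   = refl
det-⇔ (ofʸ x)  (ofⁿ ¬y) A⇔B = contradiction (Equivalence.to A⇔B x) ¬y
det-⇔ (ofⁿ ¬x) (ofʸ y)  A⇔B = contradiction (Equivalence.from A⇔B y) ¬x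
det-⇔ (ofⁿ _)  (ofⁿ _)  _   = refl

reflects-false : ∀ {A : Set} {a} → Reflects A a → ¬ A → a ≡ false
reflects-false r ¬x = det r (ofⁿ ¬x)

count : (ℕ → Bool) → ℕ → ℕ
count P zero    = 0
count P (suc n) = toℕ (P 0) + count (P ∘ suc) n

count-cong : ∀ {P Q} n → (∀ u → u < n → P u ≡ Q u) → count P n ≡ count Q n
count-cong zero    _   = refl
count-cong (suc n) P≡Q =
  cong₂ _+_ (cong toℕ (P≡Q 0 z<s)) (count-cong n (λ u u<n → P≡Q (suc u) (s<s u<n)))

count-false : ∀ n → count (λ _ → false) n ≡ 0
count-false zero    = refl
count-false (suc n) = count-false n

count-suc-last : ∀ P n → count P (suc n) ≡ count P n + toℕ (P n)
count-suc-last P zero    = +-comm (toℕ (P 0)) 0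
count-suc-last P (suc n) =
  trans (cong (_+_ (toℕ (P 0))) (count-suc-last (P ∘ suc) n)) (sym (+-assoc (toℕ (P 0)) _ _))

count-∨ : ∀ {P R} n → (∀ u → P u ∧ R u ≡ false) →
          count (λ u → P u ∨ R u) n ≡ count P n + count R n
count-∨ zero _ = refl
count-∨ {P} {R} (suc n) disjoint =
  trans (cong₂ _+_ (toℕ-∨ (P 0) (R 0) (disjoint 0)) (count-∨ n (disjoint ∘ suc)))
        (interchange (toℕ (P 0)) (toℕ (R 0)) (count (P ∘ suc) n) (count (R ∘ suc) n))
  where
  toℕ-∨ : ∀ a b → a ∧ b ≡ false → toℕ (a ∨ b) ≡ toℕ a + toℕ b
  toℕ-∨ true  false _ = refl
  toℕ-∨ false _     _ = refl
  interchange : ∀ a b c d → (a + b) + (c + d) ≡ (a + c) + (b + d)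
  interchange = solve-∀

count-*2 : ∀ P n → count P (n * 2) ≡ count (λ w → P (w * 2)) n + count (λ w → P (suc (w * 2))) n
count-*2 P zero    = refl
count-*2 P (suc n) = begin
  toℕ (P 0) + (toℕ (P 1) + count (P ∘ suc ∘ suc) (n * 2))
    ≡⟨ cong (λ c → toℕ (P 0) + (toℕ (P 1) + c)) (count-*2 (P ∘ suc ∘ suc) n) ⟩
  toℕ (P 0) + (toℕ (P 1) + (count (λ w → P (suc w * 2)) n + count (λ w → P (suc (suc w * 2))) n))
    ≡⟨ interchange (toℕ (P 0)) (toℕ (P 1)) _ _ ⟩
  (toℕ (P 0) + count (λ w → P (suc w * 2)) n) + (toℕ (P 1) + count (λ w → P (suc (suc w * 2))) n) ∎
  where
  open ≡-Reasoning
  interchange : ∀ a b c d → a + (b + (c + d)) ≡ (a + c) + (b + d)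
  interchange = solve-∀

length-filter≡count : ∀ (P : ℕ → Bool) (f : ℕ → ℕ) n →
  length (filter (λ v → P v ≟B true) (applyUpTo f n)) ≡ count (P ∘ f) n
length-filter≡count P f zero = refl
length-filter≡count P f (suc n) with P (f 0)
... | true  = cong suc (length-filter≡count P (f ∘ suc) n)
... | false = length-filter≡count P (f ∘ suc) n

-- Powers of ζ

any-upTo-reflects : ∀ (p : ℕ → Bool) n → Reflects (∃[ u ] u < n × T (p u)) (any p (upTo n))
any-upTo-reflects p n = fromEquivalence
  (λ t → let u , u∈ , pu = find (any⁻ p (upTo n) t) in u , ∈-upTo⁻ u∈ , pu)
  (λ (u , u<n , pu) → any⁺ p (lose (∈-upTo⁺ u<n) pu))

hit≡ : ∀ m P {v} → v < ord m → hit m P v ≡ P v ∨ (P (ord m) ∧ (v ≡ᵇ 0))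
hit≡ m P {v} v<N = det-⇔
  (any-upTo-reflects _ (suc N))
  (T-reflects (P v) ⊎-reflects (T-reflects (P N) ×-reflects ≡ᵇ-reflects-≡ v 0))
  (mk⇔ to from)
  where
  N = ord m
  ζ-exponent : ℕ → Set
  ζ-exponent u = u < suc N × T (P u ∧ (if u ≡ᵇ N then v ≡ᵇ 0 else u ≡ᵇ v))
  to : ∃[ u ] ζ-exponent u → T (P v) ⊎ (T (P N) × v ≡ 0)
  to (u , _ , Pu∧eq) with u ≡ᵇ N in u≡ᵇN | Equivalence.to (T-∧ {P u}) Pu∧eq
  ... | true  | Pu , v≡ᵇ0 =
    inj₂ (subst (T ∘ P) (≡ᵇ⇒≡ u N (subst T (sym u≡ᵇN) _)) Pu , ≡ᵇ⇒≡ v 0 v≡ᵇ0)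
  ... | false | Pu , u≡ᵇv = inj₁ (subst (T ∘ P) (≡ᵇ⇒≡ u v u≡ᵇv) Pu)
  from : T (P v) ⊎ (T (P N) × v ≡ 0) → ∃[ u ] ζ-exponent u
  from (inj₁ Pv) = v , m<n⇒m<1+n v<N , Equivalence.from T-∧ (Pv , subst
    (λ c → T (if c then v ≡ᵇ 0 else v ≡ᵇ v))
    (sym (reflects-false (≡ᵇ-reflects-≡ v N) (<⇒≢ v<N))) (≡⇒≡ᵇ v v refl))
  from (inj₂ (PN , v≡0)) = N , n<1+n N , Equivalence.from T-∧ (PN , subst
    (λ c → T (if c then v ≡ᵇ 0 else N ≡ᵇ v))
    (sym (det (≡ᵇ-reflects-≡ N N) (ofʸ refl))) (≡⇒≡ᵇ v 0 v≡0))

count-wrap : ∀ P {N} → 1 ≤ N →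
  count (λ v → P v ∨ (P N ∧ (v ≡ᵇ 0))) N + toℕ (P 0 ∧ P N) ≡ count P (suc N)
count-wrap P {suc n} _ = begin
  toℕ (P 0 ∨ (b ∧ true)) + count (λ v → P (suc v) ∨ (b ∧ false)) n + toℕ (P 0 ∧ b)
    ≡⟨ cong (λ c → toℕ (P 0 ∨ (b ∧ true)) + c + toℕ (P 0 ∧ b))
            (count-cong n (λ v _ → trans (cong (P (suc v) ∨_) (∧-zeroʳ b)) (∨-identityʳ _))) ⟩
  toℕ (P 0 ∨ (b ∧ true)) + count (P ∘ suc) n + toℕ (P 0 ∧ b)
    ≡⟨ inclusion-exclusion (P 0) b _ ⟩
  toℕ (P 0) + (count (P ∘ suc) n + toℕ b)
    ≡⟨ cong (_+_ (toℕ (P 0))) (sym (count-suc-last (P ∘ suc) n)) ⟩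
  count P (suc (suc n)) ∎
  where
  open ≡-Reasoning
  b = P (suc n)
  inclusion-exclusion : ∀ a b x → toℕ (a ∨ (b ∧ true)) + x + toℕ (a ∧ b) ≡ toℕ a + (x + toℕ b)
  inclusion-exclusion true  true  x = refl
  inclusion-exclusion true  false x = refl
  inclusion-exclusion false true  x = trans (+-identityʳ (1 + x)) (+-comm 1 x)
  inclusion-exclusion false false x = refl

suc-ord : ∀ m → suc (ord m) ≡ 4 ^ m
suc-ord m = trans (sym (+-∸-assoc 1 (m^n>0 4 m))) (m+n∸m≡n 1 (4 ^ m))

ord-suc : ∀ m → ord (suc m) ≡ suc (suc (ord m * 2) * 2)
ord-suc m = trans (cong (λ x → 4 * x ∸ 1) (sym (suc-ord m))) (cong (_∸ 1) (4[1+x]≡1+[3+4x] (ord m)))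
  where
  4[1+x]≡1+[3+4x] : ∀ x → 4 * suc x ≡ 1 + suc (suc (x * 2) * 2)
  4[1+x]≡1+[3+4x] = solve-∀

card+ends≡count : ∀ m P → 1 ≤ m → card m P + toℕ (P 0 ∧ P (ord m)) ≡ count P (4 ^ m)
card+ends≡count m P 1≤m = begin
  card m P + toℕ (P 0 ∧ P (ord m))
    ≡⟨ cong (_+ ends) (length-filter≡count (hit m P) (λ v → v) (ord m)) ⟩
  count (hit m P) (ord m) + toℕ (P 0 ∧ P (ord m))
    ≡⟨ cong (_+ ends) (count-cong (ord m) (λ _ → hit≡ m P)) ⟩
  count (λ v → P v ∨ (P (ord m) ∧ (v ≡ᵇ 0))) (ord m) + toℕ (P 0 ∧ P (ord m))
    ≡⟨ count-wrap P (1≤ord m 1≤m) ⟩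
  count P (suc (ord m))
    ≡⟨ cong (count P) (suc-ord m) ⟩
  count P (4 ^ m) ∎
  where
  open ≡-Reasoning
  ends = toℕ (P 0 ∧ P (ord m))
  1≤ord : ∀ m → 1 ≤ m → 1 ≤ ord m
  1≤ord (suc m) _ = subst (1 ≤_) (sym (ord-suc m)) (s≤s z≤n)

sum-upTo-suc : ∀ (f : ℕ → ℕ) n → sum (map f (upTo (suc n))) ≡ f 0 + sum (map (f ∘ suc) (upTo n))
sum-upTo-suc f n =
  cong (λ xs → f 0 + sum xs) (trans (map-applyUpTo suc f n) (sym (map-upTo (f ∘ suc) n)))

sum-upTo-cong : ∀ {f g : ℕ → ℕ} n → (∀ i → f i ≡ g i) →
                sum (map f (upTo n)) ≡ sum (map g (upTo n))
sum-upTo-cong n f≗g = cong sum (map-cong f≗g (upTo n))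

Ocnt-suc : ∀ m u → Ocnt (suc m) u ≡ digit u 1 + Ocnt m (u / 2 / 2)
Ocnt-suc m u = trans (sum-upTo-suc _ m)
  (cong (_+_ (digit u 1)) (sum-upTo-cong m (λ i → cong (digit u) (2[1+i]+1≡2+[2i+1] i))))
  where
  2[1+i]+1≡2+[2i+1] : ∀ i → 2 * suc i + 1 ≡ suc (suc (2 * i + 1))
  2[1+i]+1≡2+[2i+1] = solve-∀

Ecnt-suc : ∀ m u → Ecnt (suc m) u ≡ digit u 0 + Ecnt m (u / 2 / 2)
Ecnt-suc m u = trans (sum-upTo-suc _ m)
  (cong (_+_ (digit u 0)) (sum-upTo-cong m (λ i → cong (digit u) (2[1+i]≡2+2i i))))
  where
  2[1+i]≡2+2i : ∀ i → 2 * suc i ≡ suc (suc (2 * i))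
  2[1+i]≡2+2i = solve-∀

wt2≡Ocnt+Ecnt : ∀ m u → wt2 m u ≡ Ocnt m u + Ecnt m u
wt2≡Ocnt+Ecnt zero    u = refl
wt2≡Ocnt+Ecnt (suc m) u = begin
  sum (map (digit u) (upTo (2 * suc m)))
    ≡⟨ cong (λ n → sum (map (digit u) (upTo n))) (2[1+m]≡2+2m m) ⟩
  sum (map (digit u) (upTo (suc (suc (2 * m)))))
    ≡⟨ trans (sum-upTo-suc (digit u) (suc (2 * m)))
             (cong (_+_ (digit u 0)) (sum-upTo-suc (digit u ∘ suc) (2 * m))) ⟩
  digit u 0 + (digit u 1 + wt2 m w)
    ≡⟨ cong (λ x → digit u 0 + (digit u 1 + x)) (wt2≡Ocnt+Ecnt m w) ⟩
  digit u 0 + (digit u 1 + (Ocnt m w + Ecnt m w))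
    ≡⟨ regroup (digit u 0) (digit u 1) (Ocnt m w) (Ecnt m w) ⟩
  (digit u 1 + Ocnt m w) + (digit u 0 + Ecnt m w)
    ≡⟨ sym (cong₂ _+_ (Ocnt-suc m u) (Ecnt-suc m u)) ⟩
  Ocnt (suc m) u + Ecnt (suc m) u ∎
  where
  open ≡-Reasoning
  w = u / 2 / 2
  2[1+m]≡2+2m : ∀ m → 2 * suc m ≡ suc (suc (2 * m))
  2[1+m]≡2+2m = solve-∀
  regroup : ∀ a b c d → a + (b + (c + d)) ≡ (b + c) + (a + d)
  regroup = solve-∀

Ecnt≤ : ∀ m u → Ecnt m u ≤ m
Ecnt≤ zero    u = z≤n
Ecnt≤ (suc m) u =
  subst (_≤ suc m) (sym (Ecnt-suc m u)) (+-mono-≤ (≤-pred (m%n<n u 2)) (Ecnt≤ m (u / 2 / 2)))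

[b+w*2]%2≡b : ∀ b w → (toℕ b + w * 2) % 2 ≡ toℕ b
[b+w*2]%2≡b false w = m*n%n≡0 w 2
[b+w*2]%2≡b true  w = [m+kn]%n≡m%n 1 w 2

[b+w*2]/2≡w : ∀ b w → (toℕ b + w * 2) / 2 ≡ w
[b+w*2]/2≡w b w =
  trans (+-distrib-/-∣ʳ (toℕ b) (divides w refl)) (cong₂ _+_ (b/2≡0 b) (m*n/n≡m w 2))
  where
  b/2≡0 : ∀ b → toℕ b / 2 ≡ 0
  b/2≡0 false = refl
  b/2≡0 true  = refl

-- a + 2b + 4w: the base-4 digit 2b + a followed by the digits of w.
prepend : Bool → Bool → ℕ → ℕ
prepend a b w = toℕ a + (toℕ b + w * 2) * 2

prepend/2≡ : ∀ a b w → prepend a b w / 2 ≡ toℕ b + w * 2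
prepend/2≡ a b w = [b+w*2]/2≡w a (toℕ b + w * 2)

prepend/4≡w : ∀ a b w → prepend a b w / 2 / 2 ≡ w
prepend/4≡w a b w = trans (cong (_/ 2) (prepend/2≡ a b w)) ([b+w*2]/2≡w b w)

Ocnt-prepend : ∀ m a b w → Ocnt (suc m) (prepend a b w) ≡ toℕ b + Ocnt m w
Ocnt-prepend m a b w = trans (Ocnt-suc m _) (cong₂ (λ x y → x + Ocnt m y)
  (trans (cong (_% 2) (prepend/2≡ a b w)) ([b+w*2]%2≡b b w)) (prepend/4≡w a b w))

Ecnt-prepend : ∀ m a b w → Ecnt (suc m) (prepend a b w) ≡ toℕ a + Ecnt m w
Ecnt-prepend m a b w = trans (Ecnt-suc m _) (cong₂ (λ x y → x + Ecnt m y)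
  ([b+w*2]%2≡b a (toℕ b + w * 2)) (prepend/4≡w a b w))

Ocnt-0 : ∀ m → Ocnt m 0 ≡ 0
Ocnt-0 zero    = refl
Ocnt-0 (suc m) = trans (Ocnt-prepend m false false 0) (Ocnt-0 m)

Ecnt-0 : ∀ m → Ecnt m 0 ≡ 0
Ecnt-0 zero    = refl
Ecnt-0 (suc m) = trans (Ecnt-prepend m false false 0) (Ecnt-0 m)

Ocnt-ord : ∀ m → Ocnt m (ord m) ≡ m
Ocnt-ord zero    = refl
Ocnt-ord (suc m) =
  trans (cong (Ocnt (suc m)) (ord-suc m)) (trans (Ocnt-prepend m true true (ord m)) (cong suc (Ocnt-ord m)))

Ecnt-ord : ∀ m → Ecnt m (ord m) ≡ m
Ecnt-ord zero    = refl
Ecnt-ord (suc m) =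
  trans (cong (Ecnt (suc m)) (ord-suc m)) (trans (Ecnt-prepend m true true (ord m)) (cong suc (Ecnt-ord m)))

-- The joint distribution of O and E

countOE : ℕ → (ℕ → ℕ → Bool) → ℕ
countOE m Q = count (λ u → Q (Ocnt m u) (Ecnt m u)) (4 ^ m)

countOE-cong : ∀ m {Q Q′} → (∀ o e → e ≤ m → Q o e ≡ Q′ o e) → countOE m Q ≡ countOE m Q′
countOE-cong m Q≡Q′ = count-cong (4 ^ m) (λ u _ → Q≡Q′ (Ocnt m u) (Ecnt m u) (Ecnt≤ m u))

countOE-false : ∀ m → countOE m (λ _ _ → false) ≡ 0
countOE-false m = count-false (4 ^ m)

countOE-∨ : ∀ m Q R → (∀ o e → Q o e ∧ R o e ≡ false) →
            countOE m (λ o e → Q o e ∨ R o e) ≡ countOE m Q + countOE m R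
countOE-∨ m Q R disjoint = count-∨ (4 ^ m) (λ u → disjoint (Ocnt m u) (Ecnt m u))

countOE-suc : ∀ m Q → countOE (suc m) Q ≡
  (countOE m Q + countOE m (λ o e → Q (suc o) e))
    + (countOE m (λ o e → Q o (suc e)) + countOE m (λ o e → Q (suc o) (suc e)))
countOE-suc m Q = begin
  count P (4 ^ suc m)
    ≡⟨ cong (count P) (4x≡x*2*2 (4 ^ m)) ⟩
  count P (4 ^ m * 2 * 2)
    ≡⟨ count-*2 P (4 ^ m * 2) ⟩
  count (λ x → P (x * 2)) (4 ^ m * 2) + count (λ x → P (suc (x * 2))) (4 ^ m * 2)
    ≡⟨ cong₂ _+_ (count-*2 (λ x → P (x * 2)) (4 ^ m)) (count-*2 (λ x → P (suc (x * 2))) (4 ^ m)) ⟩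
  (count (P ∘ prepend false false) (4 ^ m) + count (P ∘ prepend false true) (4 ^ m))
    + (count (P ∘ prepend true false) (4 ^ m) + count (P ∘ prepend true true) (4 ^ m))
    ≡⟨ cong₂ _+_ (cong₂ _+_ (quarter false false) (quarter false true))
                 (cong₂ _+_ (quarter true false) (quarter true true)) ⟩
  (countOE m Q + countOE m (λ o e → Q (suc o) e))
    + (countOE m (λ o e → Q o (suc e)) + countOE m (λ o e → Q (suc o) (suc e))) ∎
  where
  open ≡-Reasoning
  P = λ u → Q (Ocnt (suc m) u) (Ecnt (suc m) u)
  4x≡x*2*2 : ∀ x → 4 * x ≡ x * 2 * 2
  4x≡x*2*2 = solve-∀
  quarter : ∀ a b → count (P ∘ prepend a b) (4 ^ m) ≡ countOE m (λ o e → Q (toℕ b + o) (toℕ a + e))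
  quarter a b = count-cong (4 ^ m) (λ w _ → cong₂ Q (Ocnt-prepend m a b w) (Ecnt-prepend m a b w))

-- shift s f is f delayed by s: the coefficient sequence of x^s · Σ f(j) x^j.
shift : ℕ → (ℕ → ℕ) → ℕ → ℕ
shift zero    f j       = f j
shift (suc s) f zero    = 0
shift (suc s) f (suc j) = shift s f j

shift-cong : ∀ s {f g : ℕ → ℕ} → (∀ i → f i ≡ g i) → ∀ j → shift s f j ≡ shift s g j
shift-cong zero    f≗g j       = f≗g j
shift-cong (suc s) f≗g zero    = refl
shift-cong (suc s) f≗g (suc j) = shift-cong s f≗g j

pascal : ∀ n j → suc n C j ≡ n C j + shift 1 (n C_) j
pascal n zero    = refl
pascal n (suc j) = trans (sym (nCk+nC[k+1]≡[n+1]C[k+1] n j)) (+-comm (n C j) (n C suc j))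

times[1+x]² : (ℕ → ℕ) → ℕ → ℕ
times[1+x]² f j = (f j + shift 1 f j) + (shift 1 f j + shift 2 f j)

pascal² : ∀ n j → suc (suc n) C j ≡ times[1+x]² (n C_) j
pascal² n j = begin
  suc (suc n) C j
    ≡⟨ pascal (suc n) j ⟩
  suc n C j + shift 1 (suc n C_) j
    ≡⟨ cong₂ _+_ (pascal n j) (shift-cong 1 (pascal n) j) ⟩
  (n C j + shift 1 (n C_) j) + shift 1 (λ i → n C i + shift 1 (n C_) i) j
    ≡⟨ cong (_+_ (n C j + shift 1 (n C_) j)) (shift-pascal j) ⟩
  times[1+x]² (n C_) j ∎
  where
  open ≡-Reasoning
  shift-pascal : ∀ j → shift 1 (λ i → n C i + shift 1 (n C_) i) j ≡ shift 1 (n C_) j + shift 2 (n C_) j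
  shift-pascal zero    = refl
  shift-pascal (suc j) = refl

-- Stated for shifted points so that the four quarters of countOE-suc are instances of the
-- induction hypothesis.
countOE-point : ∀ m s t a b →
  countOE m (λ o e → (s + o ≡ᵇ a) ∧ (t + e ≡ᵇ b)) ≡ shift s (m C_) a * shift t (m C_) b
countOE-point m (suc s) t zero    b = countOE-false m
countOE-point m (suc s) t (suc a) b = countOE-point m s t a b
countOE-point m zero (suc t) a zero =
  trans (countOE-cong m (λ o _ _ → ∧-zeroʳ (o ≡ᵇ a))) (trans (countOE-false m) (sym (*-zeroʳ (m C a))))
countOE-point m zero (suc t) a (suc b) = countOE-point m zero t a b
countOE-point zero zero zero zero    zero    = refl
countOE-point zero zero zero zero    (suc b) = refl
countOE-point zero zero zero (suc a) zero    = refl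
countOE-point zero zero zero (suc a) (suc b) = refl
countOE-point (suc m) zero zero a b = begin
  countOE (suc m) (λ o e → (o ≡ᵇ a) ∧ (e ≡ᵇ b))
    ≡⟨ countOE-suc m (λ o e → (o ≡ᵇ a) ∧ (e ≡ᵇ b)) ⟩
  (term 0 0 + term 1 0) + (term 0 1 + term 1 1)
    ≡⟨ cong₂ _+_ (cong₂ _+_ (countOE-point m 0 0 a b) (countOE-point m 1 0 a b))
                 (cong₂ _+_ (countOE-point m 0 1 a b) (countOE-point m 1 1 a b)) ⟩
  (x * y + x′ * y) + (x * y′ + x′ * y′)
    ≡⟨ factorise x x′ y y′ ⟩
  (x + x′) * (y + y′)
    ≡⟨ sym (cong₂ _*_ (pascal m a) (pascal m b)) ⟩
  (suc m C a) * (suc m C b) ∎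
  where
  open ≡-Reasoning
  term : ℕ → ℕ → ℕ
  term s t = countOE m (λ o e → (s + o ≡ᵇ a) ∧ (t + e ≡ᵇ b))
  x = m C a
  x′ = shift 1 (m C_) a
  y = m C b
  y′ = shift 1 (m C_) b
  factorise : ∀ x x′ y y′ → (x * y + x′ * y) + (x * y′ + x′ * y′) ≡ (x + x′) * (y + y′)
  factorise = solve-∀

countOE-shift : ∀ m (X : ℕ → ℕ → ℕ) s j →
  countOE m (λ o e → s + X o e ≡ᵇ j) ≡ shift s (λ i → countOE m (λ o e → X o e ≡ᵇ i)) j
countOE-shift m X zero    j       = refl
countOE-shift m X (suc s) zero    = countOE-false m
countOE-shift m X (suc s) (suc j) = countOE-shift m X s j

binomial-recurrence : (F : ℕ → ℕ → ℕ) → (∀ j → F 0 j ≡ 0 C j) →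
  (∀ m j → F (suc m) j ≡ times[1+x]² (F m) j) → ∀ m j → F m j ≡ (2 * m) C j
binomial-recurrence F base step zero    j = base j
binomial-recurrence F base step (suc m) j = begin
  F (suc m) j
    ≡⟨ step m j ⟩
  times[1+x]² (F m) j
    ≡⟨ cong₂ _+_ (cong₂ _+_ (IH j) (shift-cong 1 IH j))
                 (cong₂ _+_ (shift-cong 1 IH j) (shift-cong 2 IH j)) ⟩
  times[1+x]² ((2 * m) C_) j
    ≡⟨ sym (pascal² (2 * m) j) ⟩
  suc (suc (2 * m)) C j
    ≡⟨ cong (_C j) (2[1+m]≡2+2m m) ⟩
  2 * suc m C j ∎
  where
  open ≡-Reasoning
  IH = binomial-recurrence F base step m
  2[1+m]≡2+2m : ∀ m → suc (suc (2 * m)) ≡ 2 * suc m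
  2[1+m]≡2+2m = solve-∀

countOE-sum : ∀ m j → countOE m (λ o e → o + e ≡ᵇ j) ≡ (2 * m) C j
countOE-sum = binomial-recurrence _ (λ { zero → refl ; (suc _) → refl }) step
  where
  step : ∀ m j → countOE (suc m) (λ o e → o + e ≡ᵇ j) ≡
                 times[1+x]² (λ i → countOE m (λ o e → o + e ≡ᵇ i)) j
  step m j = trans (countOE-suc m (λ o e → o + e ≡ᵇ j)) (cong₂ _+_
    (cong (_+_ (countOE m (λ o e → o + e ≡ᵇ j))) (countOE-shift m _+_ 1 j))
    (cong₂ _+_
      (trans (countOE-cong m (λ o e _ → cong (_≡ᵇ j) (+-suc o e))) (countOE-shift m _+_ 1 j))
      (trans (countOE-cong m (λ o e _ → cong (λ x → suc x ≡ᵇ j) (+-suc o e))) (countOE-shift m _+_ 2 j))))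

-- o + (m ∸ e) is the binary weight of u with its m even-position bits complemented.
countOE-complement : ∀ m j → countOE m (λ o e → o + (m ∸ e) ≡ᵇ j) ≡ (2 * m) C j
countOE-complement = binomial-recurrence _ (λ { zero → refl ; (suc _) → refl }) step
  where
  step : ∀ m j → countOE (suc m) (λ o e → o + (suc m ∸ e) ≡ᵇ j) ≡
                 times[1+x]² (λ i → countOE m (λ o e → o + (m ∸ e) ≡ᵇ i)) j
  step m j = begin
    countOE (suc m) (λ o e → o + (suc m ∸ e) ≡ᵇ j)
      ≡⟨ countOE-suc m (λ o e → o + (suc m ∸ e) ≡ᵇ j) ⟩
    (countOE m (λ o e → o + (suc m ∸ e) ≡ᵇ j) + countOE m (λ o e → suc (o + (suc m ∸ e)) ≡ᵇ j))
      + (F j + countOE m (λ o e → 1 + X o e ≡ᵇ j))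
      ≡⟨ cong₂ _+_
           (cong₂ _+_
             (trans (countOE-cong m (λ o e e≤m → cong (_≡ᵇ j) (X-suc o e e≤m))) (countOE-shift m X 1 j))
             (trans (countOE-cong m (λ o e e≤m → cong (λ x → suc x ≡ᵇ j) (X-suc o e e≤m)))
                    (countOE-shift m X 2 j)))
           (cong (_+_ (F j)) (countOE-shift m X 1 j)) ⟩
    (shift 1 F j + shift 2 F j) + (F j + shift 1 F j)
      ≡⟨ +-comm (shift 1 F j + shift 2 F j) (F j + shift 1 F j) ⟩
    times[1+x]² F j ∎
    where
    open ≡-Reasoning
    X : ℕ → ℕ → ℕ
    X o e = o + (m ∸ e)
    F : ℕ → ℕ
    F i = countOE m (λ o e → X o e ≡ᵇ i)
    X-suc : ∀ o e → e ≤ m → o + (suc m ∸ e) ≡ suc (X o e)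
    X-suc o e e≤m = trans (cong (_+_ o) (+-∸-assoc 1 e≤m)) (+-suc o (m ∸ e))

m+m≡2*m : ∀ m → m + m ≡ 2 * m
m+m≡2*m m = cong (_+_ m) (sym (+-identityʳ m))

∣-∣≡⇔ : ∀ m n d → ∣ m - n ∣ ≡ d ⇔ (m ≡ n + d ⊎ n ≡ m + d)
∣-∣≡⇔ m n d = mk⇔ to from
  where
  to : ∣ m - n ∣ ≡ d → m ≡ n + d ⊎ n ≡ m + d
  to ∣m-n∣≡d with ≤-total m n
  ... | inj₁ m≤n =
    inj₂ (trans (sym (m+[n∸m]≡n m≤n)) (cong (_+_ m) (trans (sym (m≤n⇒∣m-n∣≡n∸m m≤n)) ∣m-n∣≡d)))
  ... | inj₂ n≤m =
    inj₁ (trans (sym (m+[n∸m]≡n n≤m)) (cong (_+_ n) (trans (sym (m≤n⇒∣n-m∣≡n∸m n≤m)) ∣m-n∣≡d)))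
  from : m ≡ n + d ⊎ n ≡ m + d → ∣ m - n ∣ ≡ d
  from (inj₁ m≡n+d) =
    trans (cong (λ x → ∣ x - n ∣) m≡n+d) (trans (∣-∣-comm (n + d) n) (∣m-m+n∣≡n n d))
  from (inj₂ n≡m+d) = trans (cong (λ x → ∣ m - x ∣) n≡m+d) (∣m-m+n∣≡n m d)

∣o-e∣≡∣o+[m∸e]-m∣ : ∀ {m} o {e} → e ≤ m → ∣ o - e ∣ ≡ ∣ o + (m ∸ e) - m ∣
∣o-e∣≡∣o+[m∸e]-m∣ {m} o {e} e≤m = begin
  ∣ o - e ∣
    ≡⟨ sym (∣m+n-m+o∣≡∣n-o∣ (m ∸ e) o e) ⟩
  ∣ m ∸ e + o - m ∸ e + e ∣
    ≡⟨ cong₂ ∣_-_∣ (+-comm (m ∸ e) o) (trans (+-comm (m ∸ e) e) (m+[n∸m]≡n e≤m)) ⟩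
  ∣ o + (m ∸ e) - m ∣ ∎
  where open ≡-Reasoning

C-complement : ∀ a b → (a + b) C a ≡ (a + b) C b
C-complement a b = trans (nCk≡nC[n∸k] (m≤m+n a b)) (cong ((a + b) C_) (m+n∸m≡n a b))

sum-absdiff⇔ : ∀ {o e y} D →
  (o + e ≡ D + y * 2 × ∣ o - e ∣ ≡ D) ⇔ ((o ≡ y + D × e ≡ y) ⊎ (o ≡ y × e ≡ y + D))
sum-absdiff⇔ {o} {e} {y} D = mk⇔ to from
  where
  halve : ∀ {x} → D + x * 2 ≡ D + y * 2 → x ≡ y
  halve {x} eq = *-cancelʳ-≡ x y 2 (+-cancelˡ-≡ D (x * 2) (y * 2) eq)
  D+x*2≡x+D+x : ∀ x D → D + x * 2 ≡ x + D + x
  D+x*2≡x+D+x = solve-∀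
  D+x*2≡x+[x+D] : ∀ x D → D + x * 2 ≡ x + (x + D)
  D+x*2≡x+[x+D] = solve-∀
  to : o + e ≡ D + y * 2 × ∣ o - e ∣ ≡ D → (o ≡ y + D × e ≡ y) ⊎ (o ≡ y × e ≡ y + D)
  to (sum , diff) with Equivalence.to (∣-∣≡⇔ o e D) diff
  ... | inj₁ o≡e+D = inj₁ (trans o≡e+D (cong (_+ D) e≡y) , e≡y)
    where e≡y = halve (trans (D+x*2≡x+D+x e D) (trans (cong (_+ e) (sym o≡e+D)) sum))
  ... | inj₂ e≡o+D = inj₂ (o≡y , trans e≡o+D (cong (_+ D) o≡y))
    where o≡y = halve (trans (D+x*2≡x+[x+D] o D) (trans (cong (_+_ o) (sym e≡o+D)) sum))
  from : (o ≡ y + D × e ≡ y) ⊎ (o ≡ y × e ≡ y + D) → o + e ≡ D + y * 2 × ∣ o - e ∣ ≡ D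
  from (inj₁ (o≡y+D , e≡y)) =
    trans (cong₂ _+_ o≡y+D e≡y) (sym (D+x*2≡x+D+x y D)) ,
    Equivalence.from (∣-∣≡⇔ o e D) (inj₁ (trans o≡y+D (cong (_+ D) (sym e≡y))))
  from (inj₂ (o≡y , e≡y+D)) =
    trans (cong₂ _+_ o≡y e≡y+D) (sym (D+x*2≡x+[x+D] y D)) ,
    Equivalence.from (∣-∣≡⇔ o e D) (inj₂ (trans e≡y+D (cong (_+ D) (sym o≡y))))

choose-⊖/2≡C : ∀ n {a} b x → a ≡ b + x * 2 → choose n ((a ⊖ b) /ℕ 2) ≡ n C x
choose-⊖/2≡C n b x refl = trans
  (cong (λ z → choose n (z /ℕ 2))
        (trans (ℤ.⊖-≥ (m≤m+n b (x * 2))) (cong +_ (m+n∸m≡n b (x * 2)))))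
  (cong (n C_) (m*n/n≡m x 2))

choose-⊖/2≡0 : ∀ n {a b} → a < b → choose n ((a ⊖ b) /ℕ 2) ≡ 0
choose-⊖/2≡0 n {a} {b} a<b with b ∸ a | ℤ.⊖-< a<b | m<n⇒0<n∸m a<b
... | suc t | a⊖b≡-[1+t] | _ = trans (cong (λ z → choose n (z /ℕ 2)) a⊖b≡-[1+t]) negative
  where
  negative : choose n (-[1+ t ] /ℕ 2) ≡ 0
  negative with -[1+ t ] /ℕ 2 | [n/ℕd]*d≤n -[1+ t ] 2
  ... | -[1+ _ ] | _     = refl
  ... | + q      | q*2≤z = contradiction (subst (_≤ℤ -[1+ t ]) (sym (ℤ.pos-* q 2)) q*2≤z) λ ()

-- Here (k + r − m)/2 = k − y, and C(m, k − y) = C(m, y + D) by symmetry; both are 0 when k < y.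
choose-[k+r⊖m]/2≡C[y+D] : ∀ {m k D r y} → m ≡ k + D → m + k ≡ r + y * 2 →
                    choose m (((k + r) ⊖ m) /ℕ 2) ≡ m C (y + D)
choose-[k+r⊖m]/2≡C[y+D] {k = k} {D} {r} {y} refl m+k≡r+2y with y ≤? k
... | yes y≤k with w , refl ← m≤n⇒∃[o]m+o≡n y≤k = begin
  choose (y + w + D) (((y + w + r) ⊖ (y + w + D)) /ℕ 2)
    ≡⟨ choose-⊖/2≡C (y + w + D) (y + w + D) w (trans (cong (_+_ (y + w)) r≡D+2w) (regroup₂ y w D)) ⟩
  (y + w + D) C w
    ≡⟨ cong (_C w) (regroup₃ y w D) ⟩
  (y + D + w) C w
    ≡⟨ sym (C-complement (y + D) w) ⟩
  (y + D + w) C (y + D)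
    ≡⟨ cong (_C (y + D)) (sym (regroup₃ y w D)) ⟩
  (y + w + D) C (y + D) ∎
  where
  open ≡-Reasoning
  regroup₁ : ∀ y w D → y + w + D + (y + w) ≡ D + w * 2 + y * 2
  regroup₁ = solve-∀
  regroup₂ : ∀ y w D → y + w + (D + w * 2) ≡ y + w + D + w * 2
  regroup₂ = solve-∀
  regroup₃ : ∀ y w D → y + w + D ≡ y + D + w
  regroup₃ = solve-∀
  r≡D+2w : r ≡ D + w * 2
  r≡D+2w = +-cancelʳ-≡ (y * 2) r (D + w * 2) (trans (sym m+k≡r+2y) (regroup₁ y w D))
... | no y≰k = trans (choose-⊖/2≡0 (k + D) k+r<k+D) (sym (k>n⇒nCk≡0 (+-monoˡ-< D k<y)))
  where
  k<y = ≰⇒> y≰k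
  regroup : ∀ k D → k + (k + D + k) ≡ k + D + k * 2
  regroup = solve-∀
  k+r<k+D : k + r < k + D
  k+r<k+D = +-cancelʳ-< (y * 2) (k + r) (k + D) (begin-strict
    k + r + y * 2          ≡⟨ +-assoc k r (y * 2) ⟩
    k + (r + y * 2)        ≡⟨ cong (_+_ k) (sym m+k≡r+2y) ⟩
    k + (k + D + k)        ≡⟨ regroup k D ⟩
    k + D + k * 2          <⟨ +-monoʳ-< (k + D) (*-monoˡ-< 2 k<y) ⟩
    k + D + y * 2          ∎)
    where open ≤-Reasoning

even-gap : ∀ {D d r n} → D % 2 ≡ r % 2 → D + d + r ≡ 2 * n → 2 ∣ d
even-gap {D} {d} {r} {n} D≡r[mod2] D+d+r≡2n =
  ∣m+n∣m⇒∣n (subst (2 ∣_) (sym (trans (regroup D r d) D+d+r≡2n)) (divides n (*-comm 2 n)))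
            (m%n≡0⇒n∣m (D + r) 2 (begin
               (D + r) % 2                ≡⟨ %-distribˡ-+ D r 2 ⟩
               (D % 2 + r % 2) % 2        ≡⟨ cong (λ x → (x + r % 2) % 2) D≡r[mod2] ⟩
               (r % 2 + r % 2) % 2        ≡⟨ cong (_% 2) (x+x≡x*2 (r % 2)) ⟩
               (r % 2 * 2) % 2            ≡⟨ m*n%n≡0 (r % 2) 2 ⟩
               0 ∎))
  where
  open ≡-Reasoning
  regroup : ∀ D r d → D + r + d ≡ D + d + r
  regroup = solve-∀
  x+x≡x*2 : ∀ x → x + x ≡ x * 2
  x+x≡x*2 = solve-∀

-- Level sets of (O, E)

countOE-sum<absdiff : ∀ m {s D} → s < D →
                      countOE m (λ o e → (o + e ≡ᵇ s) ∧ (∣ o - e ∣ ≡ᵇ D)) ≡ 0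
countOE-sum<absdiff m {s} {D} s<D = trans
  (countOE-cong m (λ o e _ →
    reflects-false (≡ᵇ-reflects-≡ (o + e) s ×-reflects ≡ᵇ-reflects-≡ ∣ o - e ∣ D)
      (λ (sum , diff) → <⇒≱ s<D (subst₂ _≤_ diff sum (≤-trans (∣m-n∣≤m⊔n o e) (m⊔n≤m+n o e))))))
  (countOE-false m)

countOE-sum-absdiff : ∀ m D y → 0 < D →
  countOE m (λ o e → (o + e ≡ᵇ D + y * 2) ∧ (∣ o - e ∣ ≡ᵇ D)) ≡ 2 * ((m C y) * (m C (y + D)))
countOE-sum-absdiff m D y 0<D = begin
  countOE m (λ o e → (o + e ≡ᵇ D + y * 2) ∧ (∣ o - e ∣ ≡ᵇ D))
    ≡⟨ countOE-cong m (λ o e _ →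
         det-⇔ (sum-absdiff-reflects o e) (two-points-reflects o e) (sum-absdiff⇔ D)) ⟩
  countOE m (λ o e → ((o ≡ᵇ y + D) ∧ (e ≡ᵇ y)) ∨ ((o ≡ᵇ y) ∧ (e ≡ᵇ y + D)))
    ≡⟨ countOE-∨ m (λ o e → (o ≡ᵇ y + D) ∧ (e ≡ᵇ y)) (λ o e → (o ≡ᵇ y) ∧ (e ≡ᵇ y + D))
         (λ o e → reflects-false (point-reflects o e (y + D) y ×-reflects point-reflects o e y (y + D))
                                 (λ ((o≡y+D , _) , (o≡y , _)) → y+D≢y (trans (sym o≡y+D) o≡y))) ⟩
  countOE m (λ o e → (o ≡ᵇ y + D) ∧ (e ≡ᵇ y))
    + countOE m (λ o e → (o ≡ᵇ y) ∧ (e ≡ᵇ y + D))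
    ≡⟨ cong₂ _+_ (countOE-point m 0 0 (y + D) y) (countOE-point m 0 0 y (y + D)) ⟩
  (m C (y + D)) * (m C y) + (m C y) * (m C (y + D))
    ≡⟨ ab+ba≡2ba (m C (y + D)) (m C y) ⟩
  2 * ((m C y) * (m C (y + D))) ∎
  where
  open ≡-Reasoning
  point-reflects : ∀ o e a b → Reflects (o ≡ a × e ≡ b) ((o ≡ᵇ a) ∧ (e ≡ᵇ b))
  point-reflects o e a b = ≡ᵇ-reflects-≡ o a ×-reflects ≡ᵇ-reflects-≡ e b
  sum-absdiff-reflects : ∀ o e → Reflects (o + e ≡ D + y * 2 × ∣ o - e ∣ ≡ D)
                                         ((o + e ≡ᵇ D + y * 2) ∧ (∣ o - e ∣ ≡ᵇ D))
  sum-absdiff-reflects o e =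
    ≡ᵇ-reflects-≡ (o + e) (D + y * 2) ×-reflects ≡ᵇ-reflects-≡ ∣ o - e ∣ D
  two-points-reflects : ∀ o e → Reflects ((o ≡ y + D × e ≡ y) ⊎ (o ≡ y × e ≡ y + D))
                                        (((o ≡ᵇ y + D) ∧ (e ≡ᵇ y)) ∨ ((o ≡ᵇ y) ∧ (e ≡ᵇ y + D)))
  two-points-reflects o e = point-reflects o e (y + D) y ⊎-reflects point-reflects o e y (y + D)
  y+D≢y : y + D ≢ y
  y+D≢y eq = <⇒≢ 0<D (sym (+-cancelˡ-≡ y D 0 (trans eq (sym (+-identityʳ y)))))
  ab+ba≡2ba : ∀ a b → a * b + b * a ≡ 2 * (b * a)
  ab+ba≡2ba = solve-∀

countOE-sum-absdiff-zero : ∀ m y →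
  countOE m (λ o e → (o + e ≡ᵇ y * 2) ∧ (∣ o - e ∣ ≡ᵇ 0)) ≡ (m C y) * (m C y)
countOE-sum-absdiff-zero m y = trans
  (countOE-cong m (λ o e _ →
    det-⇔ (≡ᵇ-reflects-≡ (o + e) (y * 2) ×-reflects ≡ᵇ-reflects-≡ ∣ o - e ∣ 0)
          (≡ᵇ-reflects-≡ o y ×-reflects ≡ᵇ-reflects-≡ e y) balanced))
  (countOE-point m 0 0 y y)
  where
  y+0≡y = +-identityʳ y
  balanced : ∀ {o e} → (o + e ≡ y * 2 × ∣ o - e ∣ ≡ 0) ⇔ (o ≡ y × e ≡ y)
  balanced {o} {e} = mk⇔
    (λ h → [ (λ (p , q) → trans p y+0≡y , q) , (λ (p , q) → p , trans q y+0≡y) ]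
            (Equivalence.to (sum-absdiff⇔ {o} {e} {y} 0) h))
    (λ (p , q) → Equivalence.from (sum-absdiff⇔ {o} {e} {y} 0) (inj₂ (p , trans q (sym y+0≡y))))

card+ends≡countOE : ∀ m {P} Q → 1 ≤ m → (∀ u → P u ≡ Q (Ocnt m u) (Ecnt m u)) →
                    card m P + toℕ (Q 0 0 ∧ Q m m) ≡ countOE m Q
card+ends≡countOE m {P} Q 1≤m P≡Q = begin
  card m P + toℕ (Q 0 0 ∧ Q m m)
    ≡⟨ cong (λ b → card m P + toℕ b) (sym ends) ⟩
  card m P + toℕ (P 0 ∧ P (ord m))
    ≡⟨ card+ends≡count m P 1≤m ⟩
  count P (4 ^ m)
    ≡⟨ count-cong (4 ^ m) (λ u _ → P≡Q u) ⟩
  countOE m Q ∎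
  where
  open ≡-Reasoning
  ends : P 0 ∧ P (ord m) ≡ Q 0 0 ∧ Q m m
  ends = cong₂ _∧_ (trans (P≡Q 0) (cong₂ Q (Ocnt-0 m) (Ecnt-0 m)))
                   (trans (P≡Q (ord m)) (cong₂ Q (Ocnt-ord m) (Ecnt-ord m)))

card≡countOE : ∀ m {P} Q → 1 ≤ m → (∀ u → P u ≡ Q (Ocnt m u) (Ecnt m u)) →
               Q 0 0 ∧ Q m m ≡ false → card m P ≡ countOE m Q
card≡countOE m {P} Q 1≤m P≡Q ends-excluded = begin
  card m P                         ≡⟨ sym (+-identityʳ (card m P)) ⟩
  card m P + toℕ false             ≡⟨ cong (λ b → card m P + toℕ b) (sym ends-excluded) ⟩
  card m P + toℕ (Q 0 0 ∧ Q m m)   ≡⟨ card+ends≡countOE m Q 1≤m P≡Q ⟩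
  countOE m Q ∎
  where open ≡-Reasoning

ends-differ-in-sum : ∀ {m} → 1 ≤ m → ∀ s → (0 ≡ᵇ s) ∧ (m + m ≡ᵇ s) ≡ false
ends-differ-in-sum (s≤s _) zero    = refl
ends-differ-in-sum _       (suc s) = refl

ends-differ-in-sum-∧ : ∀ {m} → 1 ≤ m → ∀ s x y →
                       ((0 ≡ᵇ s) ∧ x) ∧ ((m + m ≡ᵇ s) ∧ y) ≡ false
ends-differ-in-sum-∧ (s≤s _) zero    x _ = ∧-zeroʳ x
ends-differ-in-sum-∧ _       (suc s) _ _ = refl

cardΘr≡ : ∀ {m r} → 1 ≤ m → r ≤ 2 * m → cardΘr m r ≡ (2 * m) C r
cardΘr≡ {m} {r} 1≤m r≤2m = begin
  cardΘr m r
    ≡⟨ card≡countOE m (λ o e → o + e ≡ᵇ s) 1≤m (λ u → cong (_≡ᵇ s) (wt2≡Ocnt+Ecnt m u))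
                    (ends-differ-in-sum 1≤m s) ⟩
  countOE m (λ o e → o + e ≡ᵇ s)
    ≡⟨ countOE-sum m s ⟩
  (2 * m) C s
    ≡⟨ sym (nCk≡nC[n∸k] r≤2m) ⟩
  (2 * m) C r ∎
  where
  open ≡-Reasoning
  s = 2 * m ∸ r

cardΘk≡ : ∀ {m k} → 1 ≤ m → k < m → cardΘk m k ≡ 2 * ((2 * m) C k)
cardΘk≡ {m} {k} 1≤m k<m = begin
  cardΘk m k
    ≡⟨ card≡countOE m (λ o e → ∣ o - e ∣ ≡ᵇ D) 1≤m (λ _ → refl)
         (cong (_∧ (∣ m - m ∣ ≡ᵇ D))
               (reflects-false (≡ᵇ-reflects-≡ 0 D) (<⇒≢ (m<n⇒0<n∸m k<m)))) ⟩
  countOE m (λ o e → ∣ o - e ∣ ≡ᵇ D)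
    ≡⟨ countOE-cong m (λ o e e≤m → det-⇔ (≡ᵇ-reflects-≡ ∣ o - e ∣ D)
         (≡ᵇ-reflects-≡ (X o e) (m + D) ⊎-reflects ≡ᵇ-reflects-≡ (X o e) k) (split o e≤m)) ⟩
  countOE m (λ o e → (X o e ≡ᵇ m + D) ∨ (X o e ≡ᵇ k))
    ≡⟨ countOE-∨ m (λ o e → X o e ≡ᵇ m + D) (λ o e → X o e ≡ᵇ k) (λ o e →
         reflects-false (≡ᵇ-reflects-≡ (X o e) (m + D) ×-reflects ≡ᵇ-reflects-≡ (X o e) k)
                        (λ (p , q) → <⇒≢ k<m+D (trans (sym q) p))) ⟩
  countOE m (λ o e → X o e ≡ᵇ m + D) + countOE m (λ o e → X o e ≡ᵇ k)
    ≡⟨ cong₂ _+_ (countOE-complement m (m + D)) (countOE-complement m k) ⟩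
  (2 * m) C (m + D) + (2 * m) C k
    ≡⟨ cong (_+ (2 * m) C k) (begin
         (2 * m) C (m + D)         ≡⟨ cong (_C (m + D)) 2m≡m+D+k ⟩
         (m + D + k) C (m + D)     ≡⟨ C-complement (m + D) k ⟩
         (m + D + k) C k           ≡⟨ cong (_C k) (sym 2m≡m+D+k) ⟩
         (2 * m) C k ∎) ⟩
  (2 * m) C k + (2 * m) C k
    ≡⟨ m+m≡2*m ((2 * m) C k) ⟩
  2 * ((2 * m) C k) ∎
  where
  open ≡-Reasoning
  D = m ∸ k
  X : ℕ → ℕ → ℕ
  X o e = o + (m ∸ e)
  m≡k+D : m ≡ k + D
  m≡k+D = sym (m+[n∸m]≡n (<⇒≤ k<m))
  k<m+D : k < m + D
  k<m+D = <-≤-trans k<m (m≤m+n m D)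
  2m≡m+D+k : 2 * m ≡ m + D + k
  2m≡m+D+k = trans (sym (m+m≡2*m m)) (trans (cong (_+_ m) m≡k+D) (m+[k+D]≡m+D+k m k D))
    where
    m+[k+D]≡m+D+k : ∀ m k D → m + (k + D) ≡ m + D + k
    m+[k+D]≡m+D+k = solve-∀
  split : ∀ o {e} → e ≤ m → ∣ o - e ∣ ≡ D ⇔ (X o e ≡ m + D ⊎ X o e ≡ k)
  split o {e} e≤m = mk⇔
    (λ h → map₂ (λ m≡X+D → +-cancelʳ-≡ D (X o e) k (trans (sym m≡X+D) m≡k+D))
                (Equivalence.to (∣-∣≡⇔ (X o e) m D) (trans (sym shifted) h)))
    (λ h → trans shifted (Equivalence.from (∣-∣≡⇔ (X o e) m D)
                            (map₂ (λ X≡k → trans m≡k+D (cong (_+ D) (sym X≡k))) h)))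
    where shifted = ∣o-e∣≡∣o+[m∸e]-m∣ o e≤m

cardΘm≡ : ∀ {m} → 1 ≤ m → cardΘk m m ≡ (2 * m) C m ∸ 1
cardΘm≡ {m} 1≤m = begin
  cardΘk m m
    ≡⟨ sym (m+n∸n≡m _ 1) ⟩
  cardΘk m m + 1 ∸ 1
    ≡⟨ cong (λ b → cardΘk m m + toℕ b ∸ 1) both-ends ⟩
  cardΘk m m + toℕ (Q 0 0 ∧ Q m m) ∸ 1
    ≡⟨ cong (_∸ 1) (card+ends≡countOE m Q 1≤m (λ _ → refl)) ⟩
  countOE m Q ∸ 1
    ≡⟨ cong (_∸ 1) (countOE-cong m (λ o e e≤m →
         det-⇔ (≡ᵇ-reflects-≡ ∣ o - e ∣ (m ∸ m)) (≡ᵇ-reflects-≡ (o + (m ∸ e)) m)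
               (balanced o e≤m))) ⟩
  countOE m (λ o e → o + (m ∸ e) ≡ᵇ m) ∸ 1
    ≡⟨ cong (_∸ 1) (countOE-complement m m) ⟩
  (2 * m) C m ∸ 1 ∎
  where
  open ≡-Reasoning
  Q : ℕ → ℕ → Bool
  Q o e = ∣ o - e ∣ ≡ᵇ (m ∸ m)
  both-ends : true ≡ Q 0 0 ∧ Q m m
  both-ends = sym (cong₂ (λ d x → (0 ≡ᵇ d) ∧ (x ≡ᵇ d)) (n∸n≡0 m) (∣n-n∣≡0 m))
  balanced : ∀ o {e} → e ≤ m → ∣ o - e ∣ ≡ m ∸ m ⇔ o + (m ∸ e) ≡ m
  balanced o e≤m = mk⇔
    (λ h → ∣m-n∣≡0⇒m≡n (trans (sym shifted) (trans h (n∸n≡0 m))))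
    (λ h → trans shifted (trans (m≡n⇒∣m-n∣≡0 h) (sym (n∸n≡0 m))))
    where shifted = ∣o-e∣≡∣o+[m∸e]-m∣ o e≤m

cardΘrk≡ : ∀ {m r k} → 1 ≤ m → r ≤ 2 * m → k < m → inM m r k →
  cardΘrk m r k ≡ 2 * (choose m (((m + k) ⊖ r) /ℕ 2) * choose m (((k + r) ⊖ m) /ℕ 2))
cardΘrk≡ {m} {r} {k} 1≤m r≤2m k<m k∈Mr = trans
  (card≡countOE m Q 1≤m
    (λ u → cong (λ w → (w ≡ᵇ s) ∧ (∣ Ocnt m u - Ecnt m u ∣ ≡ᵇ D)) (wt2≡Ocnt+Ecnt m u))
    (ends-differ-in-sum-∧ 1≤m s _ _))
  (by-size (s <? D))
  where
  s = 2 * m ∸ r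
  D = m ∸ k
  Q : ℕ → ℕ → Bool
  Q o e = (o + e ≡ᵇ s) ∧ (∣ o - e ∣ ≡ᵇ D)
  s+r≡2m : s + r ≡ 2 * m
  s+r≡2m = m∸n+n≡m r≤2m
  m≡k+D : m ≡ k + D
  m≡k+D = sym (m+[n∸m]≡n (<⇒≤ k<m))
  m+k+D≡s+r : m + k + D ≡ s + r
  m+k+D≡s+r =
    trans (+-assoc m k D) (trans (cong (_+_ m) (sym m≡k+D)) (trans (m+m≡2*m m) (sym s+r≡2m)))
  by-size : Dec (s < D) →
            countOE m Q ≡ 2 * (choose m (((m + k) ⊖ r) /ℕ 2) * choose m (((k + r) ⊖ m) /ℕ 2))
  by-size (yes s<D) = trans (countOE-sum<absdiff m s<D)
    (sym (cong (λ c → 2 * (c * choose m (((k + r) ⊖ m) /ℕ 2))) (choose-⊖/2≡0 m m+k<r)))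
    where
    m+k<r : m + k < r
    m+k<r = +-cancelʳ-< s (m + k) r
      (subst (m + k + s <_) (trans m+k+D≡s+r (+-comm s r)) (+-monoʳ-< (m + k) s<D))
  by-size (no s≮D)
    with divides y s∸D≡y*2 ← even-gap {D} {s ∸ D} {r} {m} k∈Mr
                                (trans (cong (_+ r) (m+[n∸m]≡n (≮⇒≥ s≮D))) s+r≡2m)
    = begin
    countOE m Q
      ≡⟨ cong (λ x → countOE m (λ o e → (o + e ≡ᵇ x) ∧ (∣ o - e ∣ ≡ᵇ D))) s≡D+y*2 ⟩
    countOE m (λ o e → (o + e ≡ᵇ D + y * 2) ∧ (∣ o - e ∣ ≡ᵇ D))
      ≡⟨ countOE-sum-absdiff m D y (m<n⇒0<n∸m k<m) ⟩
    2 * ((m C y) * (m C (y + D)))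
      ≡⟨ sym (cong₂ (λ a b → 2 * (a * b)) (choose-⊖/2≡C m r y m+k≡r+2y)
                                           (choose-[k+r⊖m]/2≡C[y+D] {y = y} m≡k+D m+k≡r+2y)) ⟩
    2 * (choose m (((m + k) ⊖ r) /ℕ 2) * choose m (((k + r) ⊖ m) /ℕ 2)) ∎
    where
    open ≡-Reasoning
    s≡D+y*2 : s ≡ D + y * 2
    s≡D+y*2 = trans (sym (m+[n∸m]≡n (≮⇒≥ s≮D))) (cong (_+_ D) s∸D≡y*2)
    regroup : ∀ D y r → D + y * 2 + r ≡ r + y * 2 + D
    regroup = solve-∀
    m+k≡r+2y : m + k ≡ r + y * 2
    m+k≡r+2y = +-cancelʳ-≡ D (m + k) (r + y * 2)
      (trans m+k+D≡s+r (trans (cong (_+ r) s≡D+y*2) (regroup D y r)))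

cardΘrm≡ : ∀ {m r} → 1 ≤ m → r ≤ 2 * m → inM m r m → cardΘrk m r m ≡ (m C (r / 2)) ^ 2
cardΘrm≡ {m} {r} 1≤m r≤2m m∈Mr
  with divides q refl ← m%n≡0⇒n∣m r 2 (trans (sym m∈Mr) (cong (_% 2) (n∸n≡0 m))) = begin
  cardΘrk m (q * 2) m
    ≡⟨ card≡countOE m Q 1≤m
         (λ u → cong (λ w → (w ≡ᵇ s) ∧ (∣ Ocnt m u - Ecnt m u ∣ ≡ᵇ m ∸ m)) (wt2≡Ocnt+Ecnt m u))
         (ends-differ-in-sum-∧ 1≤m s _ _) ⟩
  countOE m Q
    ≡⟨ cong₂ (λ x d → countOE m (λ o e → (o + e ≡ᵇ x) ∧ (∣ o - e ∣ ≡ᵇ d)))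
             s≡[m∸q]*2 (n∸n≡0 m) ⟩
  countOE m (λ o e → (o + e ≡ᵇ (m ∸ q) * 2) ∧ (∣ o - e ∣ ≡ᵇ 0))
    ≡⟨ countOE-sum-absdiff-zero m (m ∸ q) ⟩
  (m C (m ∸ q)) * (m C (m ∸ q))
    ≡⟨ cong (λ c → c * c) (sym (nCk≡nC[n∸k] q≤m)) ⟩
  (m C q) * (m C q)
    ≡⟨ cong ((m C q) *_) (sym (*-identityʳ (m C q))) ⟩
  (m C q) ^ 2
    ≡⟨ cong (λ x → (m C x) ^ 2) (sym (m*n/n≡m q 2)) ⟩
  (m C (q * 2 / 2)) ^ 2 ∎
  where
  open ≡-Reasoning
  s = 2 * m ∸ q * 2
  Q : ℕ → ℕ → Bool
  Q o e = (o + e ≡ᵇ s) ∧ (∣ o - e ∣ ≡ᵇ m ∸ m)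
  q≤m : q ≤ m
  q≤m = *-cancelʳ-≤ q m 2 (subst (q * 2 ≤_) (*-comm 2 m) r≤2m)
  s≡[m∸q]*2 : s ≡ (m ∸ q) * 2
  s≡[m∸q]*2 = trans (cong (_∸ q * 2) (*-comm 2 m)) (sym (*-distribʳ-∸ 2 m q))

lemma3p3 : (m r k : ℕ) → 1 ≤ m → r ≤ 2 * m → k ≤ m →
    (cardΘr m r ≡ (2 * m) C r)
    × ((k < m → cardΘk m k ≡ 2 * ((2 * m) C k))
       × (cardΘk m m ≡ (2 * m) C m ∸ 1))
    × (inM m r k →
        (k < m → cardΘrk m r k ≡
           2 * (choose m (((+ m -ℤ + r) +ℤ + k) /ℕ 2)
                * choose m (((+ k +ℤ + r) -ℤ + m) /ℕ 2)))
        × (k ≡ m → cardΘrk m r m ≡ (m C (r / 2)) ^ 2))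
-- The hypothesis k ≤ m is not needed: each case that involves k assumes k < m or k = m.
lemma3p3 m r k 1≤m r≤2m _ =
    cardΘr≡ 1≤m r≤2m
  , ((λ k<m → cardΘk≡ 1≤m k<m) , cardΘm≡ 1≤m)
  , λ k∈Mr →
      (λ k<m → trans (cardΘrk≡ 1≤m r≤2m k<m k∈Mr)
                     (cong₂ (λ a b → 2 * (choose m (a /ℕ 2) * choose m (b /ℕ 2)))
                            (sym m-r+k≡m+k⊖r) (sym k+r-m≡k+r⊖m)))
    , (λ k≡m → cardΘrm≡ 1≤m r≤2m (subst (inM m r) k≡m k∈Mr))
  where
  m-r+k≡m+k⊖r : (+ m -ℤ + r) +ℤ + k ≡ (m + k) ⊖ r
  m-r+k≡m+k⊖r = trans (cong (_+ℤ + k) (ℤ.m-n≡m⊖n m r)) (ℤ.distribˡ-⊖-+-pos k m r)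
  k+r-m≡k+r⊖m : (+ k +ℤ + r) -ℤ + m ≡ (k + r) ⊖ m
  k+r-m≡k+r⊖m = ℤ.m-n≡m⊖n (k + r) m
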